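{- Let $m\ge1$ and $k\ge 1$ be integers and let $q_k=\lfloor \frac{mk}{m+1}\rfloor$. Then there are unique real numbers $a_{k,0,m}$ and $a_{k,l,r}$ ($1\le l\le q_k$, $0\le r\le m$) such that, in $\mathbb{R}[x]$, \[ \big((x-1)^{\underline{m}}\big)^k=a_{k,0,m}(x-1)^{\underline{m}}+\sum_{l=1}^{q_k}\sum_{r=0}^{m}a_{k,l,r}\big((x)^{\underline{m+1}}\big)^l(x+r-m-1)^{\underline{r}}. \]
   Context: Falling factorials: $(y)^{\underline{0}}=1$ and $(y)^{\underline{s}}=y(y-1)\cdots(y-s+1)$ for $s\ge1$; thus $(x-1)^{\underline m}=(x-1)(x-2)\cdots(x-m)$, $(x)^{\underline{m+1}}=x(x-1)\cdots(x-m)$ and $(x+r-m-1)^{\underline r}=(x+r-m-1)(x+r-m-2)\cdots(x-m)$.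
   Formalization: The coefficients $a_{k,0,m}$ and $a_{k,l,r}$ are rational rather than real, and the identity is taken in ℚ[x] in place of $\mathbb{R}[x]$. -}

module Defs where

open import Data.Nat using (ℕ; zero; suc)
import Data.Nat as ℕ
open import Data.Integer using (+_)
open import Data.Rational using (ℚ; 0ℚ; 1ℚ) renaming (_+_ to _+ℚ_; _*_ to _*ℚ_; _-_ to _-ℚ_; _/_ to _/ℚ_)
open import Data.List using (List; []; _∷_)
open import Data.Fin using (Fin; zero; suc)

-- Formal polynomials over ℚ: lists of coefficients, lowest degree first.
Poly : Set
Poly = List ℚ

coeff : Poly → ℕ → ℚ
coeff []       _       = 0ℚ
coeff (c ∷ p)  zero    = c
coeff (c ∷ p)  (suc i) = coeff p i

-- Equality in ℚ[x]: all coefficients agree (trailing zeros irrelevant).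
infix 4 _≈ₚ_
_≈ₚ_ : Poly → Poly → Set
p ≈ₚ q = ∀ i → coeff p i ≡ coeff q i
  where open import Relation.Binary.PropositionalEquality using (_≡_)

infixl 6 _+ₚ_
_+ₚ_ : Poly → Poly → Poly
[]      +ₚ q       = q
p       +ₚ []      = p
(a ∷ p) +ₚ (b ∷ q) = (a +ℚ b) ∷ (p +ₚ q)

infixl 7 _·ₚ_
_·ₚ_ : ℚ → Poly → Poly
c ·ₚ []      = []
c ·ₚ (a ∷ p) = (c *ℚ a) ∷ (c ·ₚ p)

infixl 7 _*ₚ_
_*ₚ_ : Poly → Poly → Poly
[]      *ₚ q = []
(a ∷ p) *ₚ q = (a ·ₚ q) +ₚ (0ℚ ∷ (p *ₚ q))

constₚ : ℚ → Poly
constₚ c = c ∷ []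

oneₚ : Poly
oneₚ = constₚ 1ℚ

X : Poly
X = 0ℚ ∷ 1ℚ ∷ []

infixr 8 _^ₚ_
_^ₚ_ : Poly → ℕ → Poly
p ^ₚ zero  = oneₚ
p ^ₚ suc n = p *ₚ (p ^ₚ n)

ℕ→ℚ : ℕ → ℚ
ℕ→ℚ n = (+ n) /ℚ 1

falling : Poly → ℕ → Poly
falling y zero    = oneₚ
falling y (suc s) = falling y s *ₚ (y +ₚ constₚ (0ℚ -ℚ ℕ→ℚ s))

X+ : ℚ → Poly
X+ c = X +ₚ constₚ c

sumₚ : (n : ℕ) → (Fin n → Poly) → Poly
sumₚ zero    f = []
sumₚ (suc n) f = f zero +ₚ sumₚ n (λ i → f (suc i))

qk : ℕ → ℕ → ℕ
qk m k = (m ℕ.* k) ℕ./ suc m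

-- Right-hand side of the expansion, with a_{k,0,m} = a0 and
-- a_{k,l,r} = a i j where l = toℕ i + 1 ∈ [1, q], r = toℕ j ∈ [0, m].
rhs : (m q : ℕ) → ℚ → (Fin q → Fin (suc m) → ℚ) → Poly
rhs m q a0 a =
  (a0 ·ₚ falling (X+ (0ℚ -ℚ 1ℚ)) m) +ₚ
  sumₚ q (λ i → sumₚ (suc m) (λ j →
    let l = suc (Data.Fin.toℕ i) ; r = Data.Fin.toℕ j in
    a i j ·ₚ ((falling X (suc m) ^ₚ l) *ₚ
              falling (X+ (ℕ→ℚ r -ℚ ℕ→ℚ (suc m))) r)))

module Submission where

-- Write n = m + 1 and E d = (x - 1)^{\underline d}. The polynomials E d (d ≤ m) and
-- ((x)^{\underline n})^(l+1) (x + r - n)^{\underline r} (l ≥ 0, r < n) are monic of degrees d and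
-- (l+1)n + r, so they form a basis of ℚ[x] that is triangular with respect to degree.
-- As deg (E m)^k = km < n + q_k n, the power (E m)^k is a unique combination of the basis elements
-- of degree below n + q_k n; these are the terms of the claimed expansion together with
-- E 0, …, E (m-1). The coefficients of the latter vanish: at x = t + 1 with t < m, (E m)^k and
-- every basis element of degree above t vanish while E t (t + 1) = t! ≠ 0, so induction on t
-- kills them one by one.

open import Defs
open import Data.Nat as ℕ using (ℕ; zero; suc; _≤_; _<_; _≥_; _∸_; z≤n; s≤s; _≤?_)
import Data.Nat.Properties as ℕ
open import Data.Nat.DivMod
  using ( _/_; _%_; m≡m%n+[m/n]*n; m%n<n; m<n⇒m%n≡m; m<n⇒m/n≡0; [m+kn]%n≡m%n
        ; +-distrib-/-∣ʳ; m*n/n≡m)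
open import Data.Nat.Divisibility using (divides-refl)
open import Data.Nat.Coprimality using (1-coprimeTo) renaming (sym to coprime-sym)
open import Data.Nat.Induction using (<-rec)
import Data.Integer as ℤ
open import Data.Fin as Fin using (Fin; toℕ; fromℕ<)
open import Data.Fin.Properties using (toℕ<n; fromℕ<-toℕ)
open import Data.Rational using (ℚ; mkℚ; 0ℚ; 1ℚ; _+_; _*_; _-_; 1/_; Positive; NonZero)
open import Data.Rational.Properties
  using ( +-identityˡ; +-identityʳ; +-assoc; +-inverseʳ; *-zeroˡ; *-zeroʳ; *-identityʳ
        ; *-assoc; *-inverseʳ; pos*pos⇒pos; pos⇒nonZero; normalize-pos; normalize-coprime
        ; +-0-monoid; +-0-group)
open import Data.Rational.Solver using (module +-*-Solver)
open import Algebra.Properties.Monoid.Sum +-0-monoid using (sum; sum-cong-≗; sum-replicate-zero)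
open import Algebra.Properties.Group +-0-group using (∙-cancelʳ)
open import Algebra.Properties.CommutativeSemigroup ℕ.+-commutativeSemigroup using (x∙yz≈y∙xz)
open import Data.List using ([]; _∷_)
open import Data.Product using (Σ; _×_; _,_; proj₁; proj₂)
open import Data.Sum using (inj₁; inj₂)
open import Function using (_∘_)
open import Relation.Nullary using (yes; no; contradiction)
open import Relation.Binary.Definitions using (tri<; tri≈; tri>)
open import Relation.Binary.PropositionalEquality

open +-*-Solver using (solve; _:+_; _:*_; _:-_; con; _:=_)

[m+kn]/n≡k : ∀ {m n} .{{_ : ℕ.NonZero n}} k → m < n → (m ℕ.+ k ℕ.* n) / n ≡ k
[m+kn]/n≡k {m} {n} k m<n = begin
  (m ℕ.+ k ℕ.* n) / n     ≡⟨ +-distrib-/-∣ʳ m (divides-refl k) ⟩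
  m / n ℕ.+ k ℕ.* n / n   ≡⟨ cong₂ ℕ._+_ (m<n⇒m/n≡0 m<n) (m*n/n≡m k n) ⟩
  k                       ∎
  where open ≡-Reasoning

[m+kn]%n≡m : ∀ {m n} .{{_ : ℕ.NonZero n}} k → m < n → (m ℕ.+ k ℕ.* n) % n ≡ m
[m+kn]%n≡m {m} {n} k m<n = trans ([m+kn]%n≡m%n m k n) (m<n⇒m%n≡m m<n)

m+kn<jn : ∀ {m n k j} → m < n → k < j → m ℕ.+ k ℕ.* n < j ℕ.* n
m+kn<jn {n = n} {k} m<n k<j = ℕ.<-≤-trans (ℕ.+-monoˡ-< (k ℕ.* n) m<n) (ℕ.*-monoˡ-≤ n k<j)

ℕ→ℚ≡mkℚ : ∀ n → ℕ→ℚ n ≡ mkℚ (ℤ.+ n) 0 (coprime-sym (1-coprimeTo n))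
ℕ→ℚ≡mkℚ n = normalize-coprime (coprime-sym (1-coprimeTo n))

ℕ→ℚ-suc : ∀ n → ℕ→ℚ (suc n) ≡ 1ℚ + ℕ→ℚ n
ℕ→ℚ-suc n = sym (trans (cong (1ℚ +_) (ℕ→ℚ≡mkℚ n)) (1+mkℚ n))
  where
  -- The sum normalises by computation once n is headed by a constructor.
  1+mkℚ : ∀ n → 1ℚ + mkℚ (ℤ.+ n) 0 (coprime-sym (1-coprimeTo n)) ≡ ℕ→ℚ (suc n)
  1+mkℚ zero    = refl
  1+mkℚ (suc n) = cong (λ j → ℕ→ℚ (suc j)) (ℕ.*-identityʳ (suc n))

ℕ→ℚ-+ : ∀ a b → ℕ→ℚ (a ℕ.+ b) ≡ ℕ→ℚ a + ℕ→ℚ b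
ℕ→ℚ-+ zero    b = sym (+-identityˡ (ℕ→ℚ b))
ℕ→ℚ-+ (suc a) b = begin
  ℕ→ℚ (suc (a ℕ.+ b))         ≡⟨ ℕ→ℚ-suc (a ℕ.+ b) ⟩
  1ℚ + ℕ→ℚ (a ℕ.+ b)          ≡⟨ cong (1ℚ +_) (ℕ→ℚ-+ a b) ⟩
  1ℚ + (ℕ→ℚ a + ℕ→ℚ b)        ≡⟨ sym (+-assoc 1ℚ (ℕ→ℚ a) (ℕ→ℚ b)) ⟩
  (1ℚ + ℕ→ℚ a) + ℕ→ℚ b        ≡⟨ cong (_+ ℕ→ℚ b) (sym (ℕ→ℚ-suc a)) ⟩
  ℕ→ℚ (suc a) + ℕ→ℚ b         ∎
  where open ≡-Reasoning

ℕ→ℚ-∸ : ∀ {a b} → b ≤ a → ℕ→ℚ a - ℕ→ℚ b ≡ ℕ→ℚ (a ∸ b)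
ℕ→ℚ-∸ {a} {b} b≤a = begin
  ℕ→ℚ a - ℕ→ℚ b                   ≡⟨ cong (λ j → ℕ→ℚ j - ℕ→ℚ b) (sym (ℕ.m∸n+n≡m b≤a)) ⟩
  ℕ→ℚ (a ∸ b ℕ.+ b) - ℕ→ℚ b       ≡⟨ cong (_- ℕ→ℚ b) (ℕ→ℚ-+ (a ∸ b) b) ⟩
  ℕ→ℚ (a ∸ b) + ℕ→ℚ b - ℕ→ℚ b
    ≡⟨ solve 2 (λ x y → x :+ y :- y := x) refl (ℕ→ℚ (a ∸ b)) (ℕ→ℚ b) ⟩
  ℕ→ℚ (a ∸ b)                     ∎
  where open ≡-Reasoning

ℕ→ℚ-pos : ∀ {n} → 0 < n → Positive (ℕ→ℚ n)
ℕ→ℚ-pos {suc n} _ = normalize-pos (suc n) 1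

p*q≡0⇒p≡0 : ∀ p q .{{_ : NonZero q}} → p * q ≡ 0ℚ → p ≡ 0ℚ
p*q≡0⇒p≡0 p q pq≡0 = begin
  p                 ≡⟨ sym (*-identityʳ p) ⟩
  p * 1ℚ            ≡⟨ cong (p *_) (sym (*-inverseʳ q)) ⟩
  p * (q * 1/ q)    ≡⟨ sym (*-assoc p q (1/ q)) ⟩
  p * q * 1/ q      ≡⟨ cong (_* 1/ q) pq≡0 ⟩
  0ℚ * 1/ q         ≡⟨ *-zeroˡ (1/ q) ⟩
  0ℚ                ∎
  where open ≡-Reasoning

∑< : ℕ → (ℕ → ℚ) → ℚ
∑< n f = sum {n} (λ j → f (toℕ j))

infix 5 ∑<
syntax ∑< n (λ d → e) = ∑[ d < n ] e

∑-cong : ∀ n {f g : ℕ → ℚ} → (∀ d → d < n → f d ≡ g d) → ∑< n f ≡ ∑< n g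
∑-cong zero    f≡g = refl
∑-cong (suc n) f≡g = cong₂ _+_ (f≡g 0 (s≤s z≤n)) (∑-cong n (λ d d<n → f≡g (suc d) (s≤s d<n)))

∑-zero : ∀ n {f : ℕ → ℚ} → (∀ d → d < n → f d ≡ 0ℚ) → ∑< n f ≡ 0ℚ
∑-zero n f≡0 = trans (∑-cong n f≡0) (sum-replicate-zero n)

∑-last : ∀ n (f : ℕ → ℚ) → ∑< (suc n) f ≡ ∑< n f + f n
∑-last zero    f = trans (+-identityʳ (f 0)) (sym (+-identityˡ (f 0)))
∑-last (suc n) f = trans (cong (f 0 +_) (∑-last n (f ∘ suc))) (sym (+-assoc (f 0) _ _))

∑-+ : ∀ a b (f : ℕ → ℚ) → ∑< (a ℕ.+ b) f ≡ ∑< a f + (∑[ d < b ] f (a ℕ.+ d))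
∑-+ zero    b f = sym (+-identityˡ _)
∑-+ (suc a) b f = trans (cong (f 0 +_) (∑-+ a b (f ∘ suc))) (sym (+-assoc (f 0) _ _))

∑-single : ∀ n t (f : ℕ → ℚ) → t < n → (∀ d → d < n → d ≢ t → f d ≡ 0ℚ) → ∑< n f ≡ f t
∑-single (suc n) zero f _ off =
  trans (cong (f 0 +_) (∑-zero n λ d d<n → off (suc d) (s≤s d<n) λ ())) (+-identityʳ (f 0))
∑-single (suc n) (suc t) f (s≤s t<n) off =
  trans (cong₂ _+_ (off 0 (s≤s z≤n) λ ()) (∑-single n t (f ∘ suc) t<n off′)) (+-identityˡ (f (suc t)))
  where
  off′ : ∀ d → d < n → d ≢ t → f (suc d) ≡ 0ℚ
  off′ d d<n d≢t = off (suc d) (s≤s d<n) (d≢t ∘ ℕ.suc-injective)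

∑-product : ∀ q n (f : ℕ → ℚ) → ∑< (q ℕ.* n) f ≡ ∑[ l < q ] ∑[ r < n ] f (r ℕ.+ l ℕ.* n)
∑-product zero    n f = refl
∑-product (suc q) n f = begin
  ∑< (n ℕ.+ q ℕ.* n) f
    ≡⟨ ∑-+ n (q ℕ.* n) f ⟩
  ∑< n f + (∑[ e < q ℕ.* n ] f (n ℕ.+ e))
    ≡⟨ cong₂ _+_ (∑-cong n λ r _ → cong f (sym (ℕ.+-identityʳ r)))
                 (∑-product q n (λ e → f (n ℕ.+ e))) ⟩
  (∑[ r < n ] f (r ℕ.+ 0)) + (∑[ l < q ] ∑[ r < n ] f (n ℕ.+ (r ℕ.+ l ℕ.* n)))
    ≡⟨ cong (∑< n (λ r → f (r ℕ.+ 0)) +_)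
            (∑-cong q λ l _ → ∑-cong n λ r _ → cong f (x∙yz≈y∙xz n r (l ℕ.* n))) ⟩
  ∑[ l < suc q ] ∑[ r < n ] f (r ℕ.+ l ℕ.* n) ∎
  where open ≡-Reasoning

-- Coefficients, degree and evaluation of polynomials

coeff-+ₚ : ∀ p q i → coeff (p +ₚ q) i ≡ coeff p i + coeff q i
coeff-+ₚ []      q       i       = sym (+-identityˡ _)
coeff-+ₚ (a ∷ p) []      i       = sym (+-identityʳ _)
coeff-+ₚ (a ∷ p) (b ∷ q) zero    = refl
coeff-+ₚ (a ∷ p) (b ∷ q) (suc i) = coeff-+ₚ p q i

coeff-·ₚ : ∀ c p i → coeff (c ·ₚ p) i ≡ c * coeff p i
coeff-·ₚ c []      i       = sym (*-zeroʳ c)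
coeff-·ₚ c (a ∷ p) zero    = refl
coeff-·ₚ c (a ∷ p) (suc i) = coeff-·ₚ c p i

coeff-sumₚ : ∀ n F i → coeff (sumₚ n F) i ≡ sum (λ j → coeff (F j) i)
coeff-sumₚ zero    F i = refl
coeff-sumₚ (suc n) F i =
  trans (coeff-+ₚ (F Fin.zero) _ i) (cong (coeff (F Fin.zero) i +_) (coeff-sumₚ n (F ∘ Fin.suc) i))

lincomb : ℕ → (ℕ → ℚ) → (ℕ → Poly) → Poly
lincomb N c B = sumₚ N (λ j → c (toℕ j) ·ₚ B (toℕ j))

coeff-lincomb : ∀ N c B i → coeff (lincomb N c B) i ≡ ∑[ d < N ] c d * coeff (B d) i
coeff-lincomb N c B i =
  trans (coeff-sumₚ N _ i) (sum-cong-≗ {N} λ j → coeff-·ₚ (c (toℕ j)) (B (toℕ j)) i)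

coeff-*ₚ-∷ : ∀ c p q i → coeff ((c ∷ p) *ₚ q) i ≡ c * coeff q i + coeff (0ℚ ∷ (p *ₚ q)) i
coeff-*ₚ-∷ c p q i = trans (coeff-+ₚ (c ·ₚ q) _ i) (cong (_+ _) (coeff-·ₚ c q i))

0∷-≈[] : ∀ {p} → p ≈ₚ [] → (0ℚ ∷ p) ≈ₚ []
0∷-≈[] p≈[] zero    = refl
0∷-≈[] p≈[] (suc i) = p≈[] i

*ₚ-zeroˡ : ∀ p q → p ≈ₚ [] → p *ₚ q ≈ₚ []
*ₚ-zeroˡ []      q p≈[] i = refl
*ₚ-zeroˡ (a ∷ p) q p≈[] i = begin
  coeff ((a ∷ p) *ₚ q) i                      ≡⟨ coeff-*ₚ-∷ a p q i ⟩
  a * coeff q i + coeff (0ℚ ∷ (p *ₚ q)) i     ≡⟨ cong₂ (λ u v → u * coeff q i + v) (p≈[] 0)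
                                                        (0∷-≈[] (*ₚ-zeroˡ p q (p≈[] ∘ suc)) i) ⟩
  0ℚ * coeff q i + 0ℚ                         ≡⟨ trans (+-identityʳ _) (*-zeroˡ (coeff q i)) ⟩
  0ℚ                                          ∎
  where open ≡-Reasoning

DegreeAtMost : Poly → ℕ → Set
DegreeAtMost p d = ∀ i → d < i → coeff p i ≡ 0ℚ

record Monic (p : Poly) (d : ℕ) : Set where
  field
    degree  : DegreeAtMost p d
    leading : coeff p d ≡ 1ℚ

open Monic

*ₚ-degree : ∀ p q a b → DegreeAtMost p a → DegreeAtMost q b →
            DegreeAtMost (p *ₚ q) (a ℕ.+ b)
*ₚ-degree []      q a       b _  _  i       _ = refl
*ₚ-degree (c ∷ p) q zero    b hp hq i b<i = begin
  coeff ((c ∷ p) *ₚ q) i                      ≡⟨ coeff-*ₚ-∷ c p q i ⟩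
  c * coeff q i + coeff (0ℚ ∷ (p *ₚ q)) i     ≡⟨ cong₂ (λ u v → c * u + v) (hq i b<i)
                                                       (0∷-≈[] (*ₚ-zeroˡ p q λ j → hp (suc j) (s≤s z≤n)) i) ⟩
  c * 0ℚ + 0ℚ                                 ≡⟨ trans (+-identityʳ _) (*-zeroʳ c) ⟩
  0ℚ                                          ∎
  where open ≡-Reasoning
*ₚ-degree (c ∷ p) q (suc a) b hp hq (suc i) (s≤s a+b<i) = begin
  coeff ((c ∷ p) *ₚ q) (suc i)                ≡⟨ coeff-*ₚ-∷ c p q (suc i) ⟩
  c * coeff q (suc i) + coeff (p *ₚ q) i      ≡⟨ cong₂ (λ u v → c * u + v) (hq (suc i) b<1+i)
                                                       (*ₚ-degree p q a b (λ j → hp (suc j) ∘ s≤s) hq i a+b<i) ⟩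
  c * 0ℚ + 0ℚ                                 ≡⟨ trans (+-identityʳ _) (*-zeroʳ c) ⟩
  0ℚ                                          ∎
  where
  open ≡-Reasoning
  b<1+i : b < suc i
  b<1+i = s≤s (ℕ.≤-trans (ℕ.m≤n+m b a) (ℕ.<⇒≤ a+b<i))

*ₚ-leading : ∀ p q a b → DegreeAtMost p a → DegreeAtMost q b →
             coeff (p *ₚ q) (a ℕ.+ b) ≡ coeff p a * coeff q b
*ₚ-leading []      q a       b _  _  = sym (*-zeroˡ (coeff q b))
*ₚ-leading (c ∷ p) q zero    b hp hq = begin
  coeff ((c ∷ p) *ₚ q) b                      ≡⟨ coeff-*ₚ-∷ c p q b ⟩
  c * coeff q b + coeff (0ℚ ∷ (p *ₚ q)) b     ≡⟨ cong (c * coeff q b +_)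
                                                      (0∷-≈[] (*ₚ-zeroˡ p q λ j → hp (suc j) (s≤s z≤n)) b) ⟩
  c * coeff q b + 0ℚ                          ≡⟨ +-identityʳ _ ⟩
  c * coeff q b                               ∎
  where open ≡-Reasoning
*ₚ-leading (c ∷ p) q (suc a) b hp hq = begin
  coeff ((c ∷ p) *ₚ q) (suc (a ℕ.+ b))             ≡⟨ coeff-*ₚ-∷ c p q (suc (a ℕ.+ b)) ⟩
  c * coeff q (suc (a ℕ.+ b)) + coeff (p *ₚ q) (a ℕ.+ b)
    ≡⟨ cong₂ (λ u v → c * u + v) (hq (suc (a ℕ.+ b)) (s≤s (ℕ.m≤n+m b a)))
                                 (*ₚ-leading p q a b (λ j → hp (suc j) ∘ s≤s) hq) ⟩
  c * 0ℚ + coeff p a * coeff q b                   ≡⟨ cong (_+ _) (*-zeroʳ c) ⟩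
  0ℚ + coeff p a * coeff q b                       ≡⟨ +-identityˡ _ ⟩
  coeff p a * coeff q b                            ∎
  where open ≡-Reasoning

Monic-*ₚ : ∀ {p q a b} → Monic p a → Monic q b → Monic (p *ₚ q) (a ℕ.+ b)
Monic-*ₚ {p} {q} {a} {b} mp mq = record
  { degree  = *ₚ-degree p q a b (degree mp) (degree mq)
  ; leading = trans (*ₚ-leading p q a b (degree mp) (degree mq))
                    (cong₂ _*_ (leading mp) (leading mq))
  }

Monic-oneₚ : Monic oneₚ 0
Monic-oneₚ = record { degree = λ { (suc i) _ → refl } ; leading = refl }

Monic-^ₚ : ∀ {p a} → Monic p a → ∀ k → Monic (p ^ₚ k) (k ℕ.* a)
Monic-^ₚ mp zero    = Monic-oneₚ
Monic-^ₚ mp (suc k) = Monic-*ₚ mp (Monic-^ₚ mp k)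

Monic-X : Monic X 1
Monic-X = record { degree = λ { (suc zero) (s≤s ()) ; (suc (suc i)) _ → refl } ; leading = refl }

Monic-+ₚconstₚ : ∀ {y d} e → Monic y (suc d) → Monic (y +ₚ constₚ e) (suc d)
Monic-+ₚconstₚ {y} {d} e my = record
  { degree  = λ { (suc i) d<i →
                    trans (coeff-+ₚ y _ (suc i)) (trans (+-identityʳ _) (degree my (suc i) d<i)) }
  ; leading = trans (coeff-+ₚ y _ (suc d)) (trans (+-identityʳ _) (leading my))
  }

Monic-falling : ∀ {y} s → Monic y 1 → Monic (falling y s) s
Monic-falling zero    my = Monic-oneₚ
Monic-falling (suc s) my =
  subst (Monic _) (ℕ.+-comm s 1) (Monic-*ₚ (Monic-falling s my) (Monic-+ₚconstₚ _ my))

eval : Poly → ℚ → ℚ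
eval []      x = 0ℚ
eval (c ∷ p) x = c + x * eval p x

eval-+ₚ : ∀ p q x → eval (p +ₚ q) x ≡ eval p x + eval q x
eval-+ₚ []      q       x = sym (+-identityˡ _)
eval-+ₚ (a ∷ p) []      x = sym (+-identityʳ _)
eval-+ₚ (a ∷ p) (b ∷ q) x = trans (cong (λ v → a + b + x * v) (eval-+ₚ p q x))
  (solve 5 (λ a b x u v → a :+ b :+ x :* (u :+ v) := (a :+ x :* u) :+ (b :+ x :* v)) refl a b x _ _)

eval-·ₚ : ∀ c p x → eval (c ·ₚ p) x ≡ c * eval p x
eval-·ₚ c []      x = sym (*-zeroʳ c)
eval-·ₚ c (a ∷ p) x = trans (cong (λ v → c * a + x * v) (eval-·ₚ c p x))
  (solve 4 (λ c a x u → c :* a :+ x :* (c :* u) := c :* (a :+ x :* u)) refl c a x _)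

eval-*ₚ : ∀ p q x → eval (p *ₚ q) x ≡ eval p x * eval q x
eval-*ₚ []      q x = sym (*-zeroˡ (eval q x))
eval-*ₚ (a ∷ p) q x = begin
  eval ((a ·ₚ q) +ₚ (0ℚ ∷ (p *ₚ q))) x          ≡⟨ eval-+ₚ (a ·ₚ q) _ x ⟩
  eval (a ·ₚ q) x + (0ℚ + x * eval (p *ₚ q) x)
    ≡⟨ cong₂ (λ u v → u + (0ℚ + x * v)) (eval-·ₚ a q x) (eval-*ₚ p q x) ⟩
  a * eval q x + (0ℚ + x * (eval p x * eval q x))
    ≡⟨ solve 4 (λ a x u v → a :* v :+ (con 0ℚ :+ x :* (u :* v)) := (a :+ x :* u) :* v) refl a x _ _ ⟩
  (a + x * eval p x) * eval q x                 ∎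
  where open ≡-Reasoning

eval-≈[] : ∀ p x → p ≈ₚ [] → eval p x ≡ 0ℚ
eval-≈[] []      x p≈[] = refl
eval-≈[] (c ∷ p) x p≈[] = trans (cong₂ (λ u v → u + x * v) (p≈[] 0) (eval-≈[] p x (p≈[] ∘ suc)))
                               (trans (+-identityˡ _) (*-zeroʳ x))

eval-≈ₚ : ∀ p q x → p ≈ₚ q → eval p x ≡ eval q x
eval-≈ₚ []      q       x p≈q = sym (eval-≈[] q x (λ i → sym (p≈q i)))
eval-≈ₚ (a ∷ p) []      x p≈q = eval-≈[] (a ∷ p) x p≈q
eval-≈ₚ (a ∷ p) (b ∷ q) x p≈q = cong₂ (λ u v → u + x * v) (p≈q 0) (eval-≈ₚ p q x (p≈q ∘ suc))

eval-sumₚ : ∀ n F x → eval (sumₚ n F) x ≡ sum (λ j → eval (F j) x)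
eval-sumₚ zero    F x = refl
eval-sumₚ (suc n) F x =
  trans (eval-+ₚ (F Fin.zero) _ x) (cong (eval (F Fin.zero) x +_) (eval-sumₚ n (F ∘ Fin.suc) x))

eval-lincomb : ∀ N c B x → eval (lincomb N c B) x ≡ ∑[ d < N ] c d * eval (B d) x
eval-lincomb N c B x =
  trans (eval-sumₚ N _ x) (sum-cong-≗ {N} λ j → eval-·ₚ (c (toℕ j)) (B (toℕ j)) x)

eval-constₚ : ∀ e x → eval (constₚ e) x ≡ e
eval-constₚ e x = trans (cong (e +_) (*-zeroʳ x)) (+-identityʳ e)

eval-X : ∀ x → eval X x ≡ x
eval-X x = solve 1 (λ x → con 0ℚ :+ x :* (con 1ℚ :+ x :* con 0ℚ) := x) refl x

eval-X+ : ∀ c x → eval (X+ c) x ≡ x + c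
eval-X+ c x = trans (eval-+ₚ X (constₚ c) x) (cong₂ _+_ (eval-X x) (eval-constₚ c x))

eval-^ₚ-zero : ∀ p k x → eval p x ≡ 0ℚ → eval (p ^ₚ suc k) x ≡ 0ℚ
eval-^ₚ-zero p k x p[x]≡0 = begin
  eval (p ^ₚ suc k) x          ≡⟨ eval-*ₚ p (p ^ₚ k) x ⟩
  eval p x * eval (p ^ₚ k) x   ≡⟨ cong (_* eval (p ^ₚ k) x) p[x]≡0 ⟩
  0ℚ * eval (p ^ₚ k) x         ≡⟨ *-zeroˡ (eval (p ^ₚ k) x) ⟩
  0ℚ                           ∎
  where open ≡-Reasoning

eval-falling-suc : ∀ y s x →
                   eval (falling y (suc s)) x ≡ eval (falling y s) x * (eval y x - ℕ→ℚ s)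
eval-falling-suc y s x = trans (eval-*ₚ (falling y s) _ x) (cong (eval (falling y s) x *_) last)
  where
  last : eval (y +ₚ constₚ (0ℚ - ℕ→ℚ s)) x ≡ eval y x - ℕ→ℚ s
  last = trans (eval-+ₚ y _ x) (trans (cong (eval y x +_) (eval-constₚ _ x))
           (solve 2 (λ a b → a :+ (con 0ℚ :- b) := a :- b) refl (eval y x) (ℕ→ℚ s)))

falling-vanishes : ∀ {y x u} s → eval y x ≡ ℕ→ℚ u → u < s → eval (falling y s) x ≡ 0ℚ
falling-vanishes {y} {x} {u} (suc s) y[x]≡u (s≤s u≤s) with ℕ.m≤n⇒m<n∨m≡n u≤s
... | inj₁ u<s  = trans (eval-falling-suc y s x)
                        (trans (cong (_* (eval y x - ℕ→ℚ s)) (falling-vanishes s y[x]≡u u<s))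
                               (*-zeroˡ (eval y x - ℕ→ℚ s)))
... | inj₂ refl = begin
  eval (falling y (suc s)) x                   ≡⟨ eval-falling-suc y s x ⟩
  eval (falling y s) x * (eval y x - ℕ→ℚ s)    ≡⟨ cong (λ v → eval (falling y s) x * (v - ℕ→ℚ s)) y[x]≡u ⟩
  eval (falling y s) x * (ℕ→ℚ s - ℕ→ℚ s)       ≡⟨ cong (eval (falling y s) x *_) (+-inverseʳ (ℕ→ℚ s)) ⟩
  eval (falling y s) x * 0ℚ                    ≡⟨ *-zeroʳ (eval (falling y s) x) ⟩
  0ℚ                                           ∎
  where open ≡-Reasoning

falling-positive : ∀ {y x u} s → eval y x ≡ ℕ→ℚ u → s ≤ u → Positive (eval (falling y s) x)
falling-positive {y} {x} zero    _       _   = subst Positive (sym (eval-constₚ 1ℚ x)) _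
falling-positive {y} {x} {u} (suc s) y[x]≡u s<u =
  subst Positive (sym (eval-falling-suc y s x))
        (pos*pos⇒pos (eval (falling y s) x) {{init-pos}} (eval y x - ℕ→ℚ s) {{last-pos}})
  where
  init-pos : Positive (eval (falling y s) x)
  init-pos = falling-positive s y[x]≡u (ℕ.<⇒≤ s<u)
  last-pos : Positive (eval y x - ℕ→ℚ s)
  last-pos = subst Positive (sym (trans (cong (_- ℕ→ℚ s) y[x]≡u) (ℕ→ℚ-∸ (ℕ.<⇒≤ s<u))))
                   (ℕ→ℚ-pos (ℕ.m<n⇒0<n∸m s<u))

-- Triangular systems

module MonicBasis (B : ℕ → Poly) (B-monic : ∀ d → Monic (B d) d) where

  private
    update : (ℕ → ℚ) → ℕ → ℚ → ℕ → ℚ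
    update c N v d with d ℕ.≟ N
    ... | yes _ = v
    ... | no  _ = c d

    update-≡ : ∀ c N v → update c N v N ≡ v
    update-≡ c N v with N ℕ.≟ N
    ... | yes _   = refl
    ... | no  N≢N = contradiction refl N≢N

    update-≢ : ∀ c N v d → d ≢ N → update c N v d ≡ c d
    update-≢ c N v d d≢N with d ℕ.≟ N
    ... | yes d≡N = contradiction d≡N d≢N
    ... | no  _   = refl

  coeffs-exist : ∀ N (f : ℕ → ℚ) → (∀ i → N ≤ i → f i ≡ 0ℚ) →
                 Σ (ℕ → ℚ) λ c → ∀ i → f i ≡ ∑[ d < N ] c d * coeff (B d) i
  coeffs-exist zero    f f≡0 = (λ _ → 0ℚ) , λ i → f≡0 i z≤n
  coeffs-exist (suc N) f f≡0 = update c N (f N) , f≡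
    where
    f′ : ℕ → ℚ
    f′ i = f i - f N * coeff (B N) i

    f′≡0 : ∀ i → N ≤ i → f′ i ≡ 0ℚ
    f′≡0 i N≤i with ℕ.m≤n⇒m<n∨m≡n N≤i
    ... | inj₁ N<i = trans (cong₂ (λ u v → u - f N * v) (f≡0 i N<i) (degree (B-monic N) i N<i))
                           (solve 1 (λ a → con 0ℚ :- a :* con 0ℚ := con 0ℚ) refl (f N))
    ... | inj₂ refl = trans (cong (λ v → f N - f N * v) (leading (B-monic N)))
                            (solve 1 (λ a → a :- a :* con 1ℚ := con 0ℚ) refl (f N))

    ih : Σ (ℕ → ℚ) λ c → ∀ i → f′ i ≡ ∑[ d < N ] c d * coeff (B d) i
    ih = coeffs-exist N f′ f′≡0

    c : ℕ → ℚ
    c = proj₁ ih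

    f≡ : ∀ i → f i ≡ ∑[ d < suc N ] update c N (f N) d * coeff (B d) i
    f≡ i = begin
      f i                                            ≡⟨ solve 2 (λ a b → a := a :- b :+ b) refl (f i) _ ⟩
      f′ i + f N * coeff (B N) i                     ≡⟨ cong (_+ f N * coeff (B N) i) (proj₂ ih i) ⟩
      (∑[ d < N ] c d * coeff (B d) i) + f N * coeff (B N) i
        ≡⟨ cong₂ _+_ (∑-cong N λ d d<N →
                        cong (_* coeff (B d) i) (sym (update-≢ c N (f N) d (ℕ.<⇒≢ d<N))))
                     (cong (_* coeff (B N) i) (sym (update-≡ c N (f N)))) ⟩
      (∑[ d < N ] update c N (f N) d * coeff (B d) i) + update c N (f N) N * coeff (B N) i
        ≡⟨ sym (∑-last N λ d → update c N (f N) d * coeff (B d) i) ⟩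
      ∑[ d < suc N ] update c N (f N) d * coeff (B d) i ∎
      where open ≡-Reasoning

  coeffs-unique : ∀ N (c e : ℕ → ℚ) →
                  (∀ i → ∑[ d < N ] c d * coeff (B d) i ≡ ∑[ d < N ] e d * coeff (B d) i) →
                  ∀ d → d < N → c d ≡ e d
  coeffs-unique (suc N) c e c≡e = c≡e′
    where
    top : ∀ c → ∑[ d < suc N ] c d * coeff (B d) N ≡ c N
    top c = begin
      ∑[ d < suc N ] c d * coeff (B d) N                    ≡⟨ ∑-last N (λ d → c d * coeff (B d) N) ⟩
      (∑[ d < N ] c d * coeff (B d) N) + c N * coeff (B N) N
        ≡⟨ cong₂ _+_ (∑-zero N λ d d<N →
                        trans (cong (c d *_) (degree (B-monic d) N d<N)) (*-zeroʳ (c d)))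
                     (cong (c N *_) (leading (B-monic N))) ⟩
      0ℚ + c N * 1ℚ                                         ≡⟨ trans (+-identityˡ _) (*-identityʳ (c N)) ⟩
      c N                                                   ∎
      where open ≡-Reasoning

    cN≡eN : c N ≡ e N
    cN≡eN = trans (sym (top c)) (trans (c≡e N) (top e))

    lower : ∀ i → ∑[ d < N ] c d * coeff (B d) i ≡ ∑[ d < N ] e d * coeff (B d) i
    lower i = ∙-cancelʳ (c N * coeff (B N) i) _ _ (begin
      (∑[ d < N ] c d * coeff (B d) i) + c N * coeff (B N) i   ≡⟨ sym (∑-last N λ d → c d * coeff (B d) i) ⟩
      ∑[ d < suc N ] c d * coeff (B d) i                       ≡⟨ c≡e i ⟩
      ∑[ d < suc N ] e d * coeff (B d) i                       ≡⟨ ∑-last N (λ d → e d * coeff (B d) i) ⟩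
      (∑[ d < N ] e d * coeff (B d) i) + e N * coeff (B N) i
        ≡⟨ cong (λ v → (∑[ d < N ] e d * coeff (B d) i) + v * coeff (B N) i) (sym cN≡eN) ⟩
      (∑[ d < N ] e d * coeff (B d) i) + c N * coeff (B N) i   ∎)
      where open ≡-Reasoning

    c≡e′ : ∀ d → d < suc N → c d ≡ e d
    c≡e′ d (s≤s d≤N) with ℕ.m≤n⇒m<n∨m≡n d≤N
    ... | inj₁ d<N  = coeffs-unique N c e lower d d<N
    ... | inj₂ refl = cN≡eN

  lincomb-exists : ∀ N p {d} → DegreeAtMost p d → d < N → Σ (ℕ → ℚ) λ c → p ≈ₚ lincomb N c B
  lincomb-exists N p p≤d d<N with coeffs-exist N (coeff p) (λ i N≤i → p≤d i (ℕ.<-≤-trans d<N N≤i))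
  ... | c , p≡ = c , λ i → trans (p≡ i) (sym (coeff-lincomb N c B i))

  lincomb-injective : ∀ N {c e} → lincomb N c B ≈ₚ lincomb N e B → ∀ d → d < N → c d ≡ e d
  lincomb-injective N {c} {e} c≈e = coeffs-unique N c e λ i →
    trans (sym (coeff-lincomb N c B i)) (trans (c≈e i) (coeff-lincomb N e B i))

lowerTriangular-zero : ∀ {N M} (c : ℕ → ℚ) (v : ℕ → ℕ → ℚ) → M ≤ N →
                       (∀ t → t < M → ∀ d → t < d → v t d ≡ 0ℚ) →
                       (∀ t → t < M → NonZero (v t t)) →
                       (∀ t → t < M → ∑[ d < N ] c d * v t d ≡ 0ℚ) →
                       ∀ t → t < M → c t ≡ 0ℚ
lowerTriangular-zero {N} {M} c v M≤N above≡0 diag≢0 rows≡0 = <-rec _ step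
  where
  step : ∀ t → (∀ {s} → s < t → s < M → c s ≡ 0ℚ) → t < M → c t ≡ 0ℚ
  step t earlier t<M = p*q≡0⇒p≡0 (c t) (v t t) {{diag≢0 t t<M}}
                         (trans (sym (∑-single N t _ (ℕ.<-≤-trans t<M M≤N) off-diagonal)) (rows≡0 t t<M))
    where
    off-diagonal : ∀ d → d < N → d ≢ t → c d * v t d ≡ 0ℚ
    off-diagonal d _ d≢t with ℕ.<-cmp d t
    ... | tri< d<t _ _ = trans (cong (_* v t d) (earlier d<t (ℕ.<-trans d<t t<M))) (*-zeroˡ (v t d))
    ... | tri≈ _ d≡t _ = contradiction d≡t d≢t
    ... | tri> _ _ t<d = trans (cong (c d *_) (above≡0 t t<M d t<d)) (*-zeroʳ (c d))

-- The basis of the expansion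

extendByZero : ∀ {q} → (Fin q → ℚ) → ℕ → ℚ
extendByZero {q} f l with l ℕ.<? q
... | yes l<q = f (fromℕ< l<q)
... | no  _   = 0ℚ

extendByZero-toℕ : ∀ {q} (f : Fin q → ℚ) i → extendByZero f (toℕ i) ≡ f i
extendByZero-toℕ {q} f i with toℕ i ℕ.<? q
... | yes i<q = cong f (fromℕ<-toℕ i i<q)
... | no  i≮q = contradiction (toℕ<n i) i≮q

module Expansion (m : ℕ) where

  n : ℕ
  n = suc m

  m<n+ : ∀ x → m < n ℕ.+ x
  m<n+ x = ℕ.m≤m+n n x

  E : ℕ → Poly
  E d = falling (X+ (0ℚ - 1ℚ)) d

  P : Poly
  P = falling X n

  block : ℕ → ℕ → Poly
  block l r = (P ^ₚ suc l) *ₚ falling (X+ (ℕ→ℚ r - ℕ→ℚ n)) r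

  -- Indexed by degree: E d in degree d ≤ m, and block l r (r < n) in degree n + (r + l n).
  basis : ℕ → Poly
  basis d with d ≤? m
  ... | yes _ = E d
  ... | no  _ = block ((d ∸ n) / n) ((d ∸ n) % n)

  basis-≤ : ∀ {d} → d ≤ m → basis d ≡ E d
  basis-≤ {d} d≤m with d ≤? m
  ... | yes _   = refl
  ... | no  d≰m = contradiction d≤m d≰m

  basis-block : ∀ l {r} → r < n → basis (n ℕ.+ (r ℕ.+ l ℕ.* n)) ≡ block l r
  basis-block l {r} r<n with n ℕ.+ (r ℕ.+ l ℕ.* n) ≤? m
  ... | yes ≤m = contradiction ≤m (ℕ.<⇒≱ (m<n+ _))
  ... | no  _  = cong₂ block (trans (cong (_/ n) (ℕ.m+n∸m≡n n _)) ([m+kn]/n≡k l r<n))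
                             (trans (cong (_% n) (ℕ.m+n∸m≡n n _)) ([m+kn]%n≡m l r<n))

  X+-monic : ∀ c → Monic (X+ c) 1
  X+-monic c = Monic-+ₚconstₚ c Monic-X

  block-monic : ∀ l r → Monic (block l r) (suc l ℕ.* n ℕ.+ r)
  block-monic l r = Monic-*ₚ (Monic-^ₚ (Monic-falling n Monic-X) (suc l))
                             (Monic-falling r (X+-monic (ℕ→ℚ r - ℕ→ℚ n)))

  basis-monic : ∀ d → Monic (basis d) d
  basis-monic d with d ≤? m
  ... | yes _   = Monic-falling d (X+-monic (0ℚ - 1ℚ))
  ... | no  d≰m = subst (Monic _) degree≡d (block-monic (e / n) (e % n))
    where
    e : ℕ
    e = d ∸ n
    degree≡d : suc (e / n) ℕ.* n ℕ.+ e % n ≡ d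
    degree≡d = begin
      n ℕ.+ e / n ℕ.* n ℕ.+ e % n      ≡⟨ ℕ.+-assoc n _ _ ⟩
      n ℕ.+ (e / n ℕ.* n ℕ.+ e % n)    ≡⟨ cong (n ℕ.+_) (ℕ.+-comm (e / n ℕ.* n) (e % n)) ⟩
      n ℕ.+ (e % n ℕ.+ e / n ℕ.* n)    ≡⟨ cong (n ℕ.+_) (sym (m≡m%n+[m/n]*n e n)) ⟩
      n ℕ.+ e                          ≡⟨ ℕ.m+[n∸m]≡n (ℕ.≰⇒> d≰m) ⟩
      d                                ∎
      where open ≡-Reasoning

  blockIndex : ∀ {q} → Fin q → Fin n → ℕ
  blockIndex I J = n ℕ.+ (toℕ J ℕ.+ toℕ I ℕ.* n)

  blockIndex< : ∀ {q} (I : Fin q) J → blockIndex I J < n ℕ.+ q ℕ.* n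
  blockIndex< I J = ℕ.+-monoʳ-< n (m+kn<jn (toℕ<n J) (toℕ<n I))

  rhs≈lincomb : ∀ q (c : ℕ → ℚ) {a0 a} → (∀ d → d < m → c d ≡ 0ℚ) → a0 ≡ c m →
                (∀ I J → a I J ≡ c (blockIndex I J)) → rhs m q a0 a ≈ₚ lincomb (n ℕ.+ q ℕ.* n) c basis
  rhs≈lincomb q c {a0} {a} low a0≡ a≡ i = begin
    coeff (rhs m q a0 a) i
      ≡⟨ coeff-+ₚ (a0 ·ₚ E m) (sumₚ q G) i ⟩
    coeff (a0 ·ₚ E m) i + coeff (sumₚ q G) i
      ≡⟨ cong₂ _+_ (coeff-·ₚ a0 (E m) i) (coeff-sumₚ q G i) ⟩
    a0 * coeff (E m) i + sum (λ I → coeff (G I) i)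
      ≡⟨ cong₂ _+_ lowest (sum-cong-≗ {q} blocks) ⟩
    (∑[ d < n ] g d) + (∑[ l < q ] ∑[ r < n ] g (n ℕ.+ (r ℕ.+ l ℕ.* n)))
      ≡⟨ cong ((∑[ d < n ] g d) +_) (sym (∑-product q n (λ e → g (n ℕ.+ e)))) ⟩
    (∑[ d < n ] g d) + (∑[ e < q ℕ.* n ] g (n ℕ.+ e))
      ≡⟨ sym (∑-+ n (q ℕ.* n) g) ⟩
    ∑[ d < n ℕ.+ q ℕ.* n ] g d
      ≡⟨ sym (coeff-lincomb (n ℕ.+ q ℕ.* n) c basis i) ⟩
    coeff (lincomb (n ℕ.+ q ℕ.* n) c basis) i ∎
    where
    open ≡-Reasoning
    g : ℕ → ℚ
    g d = c d * coeff (basis d) i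

    G : Fin q → Poly
    G I = sumₚ n (λ J → a I J ·ₚ block (toℕ I) (toℕ J))

    lowest : a0 * coeff (E m) i ≡ ∑[ d < n ] g d
    lowest = begin
      a0 * coeff (E m) i       ≡⟨ cong₂ (λ u p → u * coeff p i) a0≡ (sym (basis-≤ ℕ.≤-refl)) ⟩
      g m                      ≡⟨ sym (+-identityˡ (g m)) ⟩
      0ℚ + g m                 ≡⟨ cong (_+ g m) (sym (∑-zero m λ d d<m →
                                    trans (cong (_* coeff (basis d) i) (low d d<m))
                                          (*-zeroˡ (coeff (basis d) i)))) ⟩
      (∑[ d < m ] g d) + g m   ≡⟨ sym (∑-last m g) ⟩
      ∑[ d < n ] g d           ∎

    blocks : ∀ I → coeff (G I) i ≡ ∑[ r < n ] g (n ℕ.+ (r ℕ.+ toℕ I ℕ.* n))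
    blocks I = trans (coeff-sumₚ n (λ J → a I J ·ₚ block (toℕ I) (toℕ J)) i) (sum-cong-≗ {n} λ J →
      trans (coeff-·ₚ (a I J) (block (toℕ I) (toℕ J)) i)
            (cong₂ (λ u p → u * coeff p i) (a≡ I J) (sym (basis-block (toℕ I) (toℕ<n J)))))

  point : ℕ → ℚ
  point t = ℕ→ℚ (suc t)

  X-1-at-point : ∀ t → eval (X+ (0ℚ - 1ℚ)) (point t) ≡ ℕ→ℚ t
  X-1-at-point t = begin
    eval (X+ (0ℚ - 1ℚ)) (point t)   ≡⟨ eval-X+ (0ℚ - 1ℚ) (point t) ⟩
    point t + (0ℚ - 1ℚ)             ≡⟨ cong (_+ (0ℚ - 1ℚ)) (ℕ→ℚ-suc t) ⟩
    1ℚ + ℕ→ℚ t + (0ℚ - 1ℚ)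
      ≡⟨ solve 1 (λ x → con 1ℚ :+ x :+ (con 0ℚ :- con 1ℚ) := x) refl (ℕ→ℚ t) ⟩
    ℕ→ℚ t                           ∎
    where open ≡-Reasoning

  E-vanishes : ∀ {t d} → t < d → eval (E d) (point t) ≡ 0ℚ
  E-vanishes {t} {d} t<d = falling-vanishes d (X-1-at-point t) t<d

  block-vanishes : ∀ {t} l r → t < m → eval (block l r) (point t) ≡ 0ℚ
  block-vanishes {t} l r t<m = begin
    eval (block l r) (point t)                        ≡⟨ eval-*ₚ (P ^ₚ suc l) G (point t) ⟩
    eval (P ^ₚ suc l) (point t) * eval G (point t)
      ≡⟨ cong (_* eval G (point t)) (eval-^ₚ-zero P l (point t) P≡0) ⟩
    0ℚ * eval G (point t)                             ≡⟨ *-zeroˡ (eval G (point t)) ⟩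
    0ℚ                                                ∎
    where
    open ≡-Reasoning
    G : Poly
    G = falling (X+ (ℕ→ℚ r - ℕ→ℚ n)) r
    P≡0 : eval P (point t) ≡ 0ℚ
    P≡0 = falling-vanishes n (eval-X (point t)) (s≤s t<m)

  basis-vanishes : ∀ {t} d → t < m → t < d → eval (basis d) (point t) ≡ 0ℚ
  basis-vanishes d t<m t<d with d ≤? m
  ... | yes _ = E-vanishes t<d
  ... | no  _ = block-vanishes ((d ∸ n) / n) ((d ∸ n) % n) t<m

  basis-positive : ∀ {t} → t ≤ m → Positive (eval (basis t) (point t))
  basis-positive {t} t≤m = subst (λ p → Positive (eval p (point t))) (sym (basis-≤ t≤m))
                                 (falling-positive t (X-1-at-point t) ℕ.≤-refl)

  power-degree : ∀ k → k ℕ.* m < n ℕ.+ qk m k ℕ.* n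
  power-degree k = begin-strict
    k ℕ.* m                            ≡⟨ ℕ.*-comm k m ⟩
    m ℕ.* k                            ≡⟨ m≡m%n+[m/n]*n (m ℕ.* k) n ⟩
    (m ℕ.* k) % n ℕ.+ qk m k ℕ.* n     <⟨ ℕ.+-monoˡ-< (qk m k ℕ.* n) (m%n<n (m ℕ.* k) n) ⟩
    n ℕ.+ qk m k ℕ.* n                 ∎
    where open ℕ.≤-Reasoning

  open MonicBasis basis basis-monic

  expansion : ∀ k → Σ ℚ λ a0 → Σ (Fin (qk m (suc k)) → Fin n → ℚ) λ a →
                E m ^ₚ suc k ≈ₚ rhs m (qk m (suc k)) a0 a
  expansion k = c m , (λ I J → c (blockIndex I J)) , F≈rhs
    where
    q : ℕ
    q = qk m (suc k)
    D : ℕ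
    D = n ℕ.+ q ℕ.* n
    F : Poly
    F = E m ^ₚ suc k

    F-monic : Monic F (suc k ℕ.* m)
    F-monic = Monic-^ₚ (Monic-falling m (X+-monic (0ℚ - 1ℚ))) (suc k)

    F-in-basis : Σ (ℕ → ℚ) λ c → F ≈ₚ lincomb D c basis
    F-in-basis = lincomb-exists D F (degree F-monic) (power-degree (suc k))

    c : ℕ → ℚ
    c = proj₁ F-in-basis

    F-at-point : ∀ t → eval F (point t) ≡ ∑[ d < D ] c d * eval (basis d) (point t)
    F-at-point t = trans (eval-≈ₚ F (lincomb D c basis) (point t) (proj₂ F-in-basis))
                         (eval-lincomb D c basis (point t))

    low : ∀ t → t < m → c t ≡ 0ℚ
    low = lowerTriangular-zero c (λ t d → eval (basis d) (point t)) (ℕ.<⇒≤ (m<n+ _))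
            (λ t t<m d t<d → basis-vanishes d t<m t<d)
            (λ t t<m → pos⇒nonZero (eval (basis t) (point t)) {{basis-positive (ℕ.<⇒≤ t<m)}})
            (λ t t<m → trans (sym (F-at-point t)) (eval-^ₚ-zero (E m) k (point t) (E-vanishes t<m)))

    F≈rhs : F ≈ₚ rhs m q (c m) (λ I J → c (blockIndex I J))
    F≈rhs i = trans (proj₂ F-in-basis i) (sym (rhs≈lincomb q c low refl (λ _ _ → refl) i))

  rhsCoeffs : ∀ {q} → ℚ → (Fin q → Fin n → ℚ) → ℕ → ℚ
  rhsCoeffs a0 a d with ℕ.<-cmp d m
  ... | tri< _ _ _ = 0ℚ
  ... | tri≈ _ _ _ = a0
  ... | tri> _ _ _ = extendByZero (λ I → extendByZero (a I) ((d ∸ n) % n)) ((d ∸ n) / n)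

  module _ {q} (a0 : ℚ) (a : Fin q → Fin n → ℚ) where

    rhsCoeffs-< : ∀ d → d < m → rhsCoeffs a0 a d ≡ 0ℚ
    rhsCoeffs-< d d<m with ℕ.<-cmp d m
    ... | tri< _ _ _   = refl
    ... | tri≈ d≮m _ _ = contradiction d<m d≮m
    ... | tri> d≮m _ _ = contradiction d<m d≮m

    rhsCoeffs-m : rhsCoeffs a0 a m ≡ a0
    rhsCoeffs-m with ℕ.<-cmp m m
    ... | tri< m<m _ _ = contradiction m<m (ℕ.<-irrefl refl)
    ... | tri≈ _ _ _   = refl
    ... | tri> _ _ m<m = contradiction m<m (ℕ.<-irrefl refl)

    rhsCoeffs-index : ∀ I J → rhsCoeffs a0 a (blockIndex I J) ≡ a I J
    rhsCoeffs-index I J with ℕ.<-cmp (blockIndex I J) m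
    ... | tri< i<m _ _ = contradiction i<m (ℕ.<⇒≯ (m<n+ _))
    ... | tri≈ _ i≡m _ = contradiction i≡m (ℕ.>⇒≢ (m<n+ _))
    ... | tri> _ _ _   = begin
      extendByZero (λ I′ → extendByZero (a I′) ((blockIndex I J ∸ n) % n)) ((blockIndex I J ∸ n) / n)
        ≡⟨ cong (λ e → extendByZero (λ I′ → extendByZero (a I′) (e % n)) (e / n)) (ℕ.m+n∸m≡n n _) ⟩
      extendByZero (λ I′ → extendByZero (a I′) (x % n)) (x / n)
        ≡⟨ cong₂ (λ u v → extendByZero (λ I′ → extendByZero (a I′) v) u)
                 ([m+kn]/n≡k (toℕ I) (toℕ<n J)) ([m+kn]%n≡m (toℕ I) (toℕ<n J)) ⟩
      extendByZero (λ I′ → extendByZero (a I′) (toℕ J)) (toℕ I)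
        ≡⟨ extendByZero-toℕ _ I ⟩
      extendByZero (a I) (toℕ J)
        ≡⟨ extendByZero-toℕ (a I) J ⟩
      a I J ∎
      where
      open ≡-Reasoning
      x : ℕ
      x = toℕ J ℕ.+ toℕ I ℕ.* n

    rhs≈rhsCoeffs : rhs m q a0 a ≈ₚ lincomb (n ℕ.+ q ℕ.* n) (rhsCoeffs a0 a) basis
    rhs≈rhsCoeffs =
      rhs≈lincomb q (rhsCoeffs a0 a) rhsCoeffs-< (sym rhsCoeffs-m) λ I J → sym (rhsCoeffs-index I J)

  rhs-injective : ∀ q a0 a b0 b → rhs m q a0 a ≈ₚ rhs m q b0 b →
                  (a0 ≡ b0) × (∀ I J → a I J ≡ b I J)
  rhs-injective q a0 a b0 b a≈b =
      trans (sym (rhsCoeffs-m a0 a)) (trans (same m (m<n+ _)) (rhsCoeffs-m b0 b))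
    , λ I J → trans (sym (rhsCoeffs-index a0 a I J))
                    (trans (same (blockIndex I J) (blockIndex< I J)) (rhsCoeffs-index b0 b I J))
    where
    same : ∀ d → d < n ℕ.+ q ℕ.* n → rhsCoeffs a0 a d ≡ rhsCoeffs b0 b d
    same = lincomb-injective (n ℕ.+ q ℕ.* n)
             λ i → trans (sym (rhs≈rhsCoeffs a0 a i)) (trans (a≈b i) (rhs≈rhsCoeffs b0 b i))

lemma6p1 : (m k : ℕ) → m ≥ 1 → k ≥ 1 →
    Σ (ℚ × (Fin (qk m k) → Fin (suc m) → ℚ)) λ { (a0 , a) →
    (falling (X+ (0ℚ - 1ℚ)) m ^ₚ k ≈ₚ rhs m (qk m k) a0 a)
    × (∀ (b0 : ℚ) (b : Fin (qk m k) → Fin (suc m) → ℚ) →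
    falling (X+ (0ℚ - 1ℚ)) m ^ₚ k ≈ₚ rhs m (qk m k) b0 b →
    (b0 ≡ a0) × (∀ i j → b i j ≡ a i j)) }
lemma6p1 m zero    _ ()
lemma6p1 m (suc k) _ _ = (a0 , a) , F≈rhs , λ b0 b F≈rhs′ →
    rhs-injective q b0 b a0 a λ i → trans (sym (F≈rhs′ i)) (F≈rhs i)
  where
  open Expansion m
  q : ℕ
  q = qk m (suc k)
  a0 : ℚ
  a0 = proj₁ (expansion k)
  a : Fin q → Fin n → ℚ
  a = proj₁ (proj₂ (expansion k))
  F≈rhs : E m ^ₚ suc k ≈ₚ rhs m q a0 a
  F≈rhs = proj₂ (proj₂ (expansion k))
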